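{- Let $G=(V,E)$ be a finite simple undirected graph and $c$ a (proper) coloring of $G$. Then $\gamma_{uc}(G,c)\geq \max\{|M_c(G)|,\gamma(G)\}$, where $M_c(G)$ is the set of local maxima of $G$ for $c$.
   Context: A coloring of $G$ is a map $c:V\to\{0,1,2,\dots\}$ with $c(u)\neq c(v)$ whenever $u,v$ are adjacent. Given $(G,c)$, a set $D\subseteq V$ is an up--color dominating $c$--set if (1) every vertex $v\notin D$ has a neighbor $d\in D$ with $c(v)<c(d)$, and (2) $D$ contains no vertex of color $0$. $\gamma_{uc}(G,c)$ is the minimum cardinality of an up--color dominating $c$--set. A vertex $v$ is a local maximum for $c$ if $c(u)\leq c(v)$ for every neighbor $u$ of $v$; $M_c(G)$ denotes the set of local maxima. $\gamma(G)$ is the domination number of $G$. -}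

module Defs where

open import Data.Nat using (ℕ; _<_; _≤_)
open import Data.Fin using (Fin)
open import Data.Fin.Subset using (Subset; _∈_; _∉_; ∣_∣)
open import Data.Product using (Σ; ∃; _×_; _,_)
open import Relation.Nullary using (¬_)
open import Relation.Binary.PropositionalEquality using (_≡_)
open import Data.Vec using (tabulate)
open import Data.Bool using (Bool; true; false)
open import Relation.Nullary.Decidable using (⌊_⌋)
open import Data.Fin.Properties using (all?)
open import Data.Nat.Properties using (_≤?_)
open import Function using (_∘_)

record Graph (n : ℕ) : Set₁ where
  field
    Adj      : Fin n → Fin n → Set
    adj?     : ∀ u v → Relation.Nullary.Dec (Adj u v)
    sym      : ∀ {u v} → Adj u v → Adj v u
    irrefl   : ∀ {v} → ¬ Adj v v
open Graph public

IsColoring : ∀ {n} → Graph n → (Fin n → ℕ) → Set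
IsColoring G c = ∀ {u v} → Adj G u v → ¬ (c u ≡ c v)

IsDominating : ∀ {n} → Graph n → Subset n → Set
IsDominating G D = ∀ v → v ∉ D → ∃ λ d → d ∈ D × Adj G v d

IsUpColorDominating : ∀ {n} → Graph n → (Fin n → ℕ) → Subset n → Set
IsUpColorDominating G c D =
  (∀ v → v ∉ D → ∃ λ d → d ∈ D × Adj G v d × c v < c d)
  × (∀ v → v ∈ D → ¬ (c v ≡ 0))

IsMinCard : ∀ {n} → (Subset n → Set) → ℕ → Set
IsMinCard P k = (∃ λ D → P D × ∣ D ∣ ≡ k) × (∀ D → P D → k ≤ ∣ D ∣)

IsDominationNumber : ∀ {n} → Graph n → ℕ → Set
IsDominationNumber G = IsMinCard (IsDominating G)

IsUpColorDominationNumber : ∀ {n} → Graph n → (Fin n → ℕ) → ℕ → Set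
IsUpColorDominationNumber G c = IsMinCard (IsUpColorDominating G c)

IsLocalMax : ∀ {n} → Graph n → (Fin n → ℕ) → Fin n → Set
IsLocalMax G c v = ∀ u → Adj G v u → c u ≤ c v

localMaxima : ∀ {n} → Graph n → (Fin n → ℕ) → Subset n
localMaxima G c =
  tabulate λ v → ⌊ all? (λ u → lemma u v) ⌋
  where
  open import Relation.Nullary using (Dec; yes; no)
  lemma : ∀ u v → Dec (Adj G v u → c u ≤ c v)
  lemma u v with adj? G v u | c u ≤? c v
  ... | _      | yes p = yes (λ _ → p)
  ... | no ¬a  | no _  = yes (λ a → Data.Empty.⊥-elim (¬a a))
    where import Data.Empty
  ... | yes a  | no ¬p = no (λ f → ¬p (f a))

{-# OPTIONS --safe #-}
module Submission where

-- A minimum up-color dominating set D is in particular dominating, so γ ≤ |D|.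
-- A local maximum has no neighbour of strictly larger colour, so it cannot be
-- up-color dominated from outside and must lie in D; hence |M_c(G)| ≤ |D|.

open import Defs
open import Data.Nat using (ℕ; _≤_; _⊔_)
open import Data.Nat.Properties using (⊔-lub; <⇒≱; ≤-trans; ≤-reflexive)
open import Data.Bool.Properties using (T-≡)
open import Data.Fin using (Fin)
open import Data.Fin.Subset using (Subset; _∈_; _⊆_; ∣_∣)
open import Data.Fin.Subset.Properties using (_∈?_; p⊆q⇒∣p∣≤∣q∣)
open import Data.Vec.Properties using ([]=⇒lookup; lookup∘tabulate)
open import Data.Product using (_,_)
open import Data.Empty using (⊥-elim)
open import Function.Bundles using (Equivalence)
open import Relation.Nullary using (yes; no)
open import Relation.Nullary.Decidable using (toWitness)
open import Relation.Binary.PropositionalEquality as ≡ using ()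

IsMinCard⇒≤ : ∀ {n} {P : Subset n → Set} {k m : ℕ} →
              IsMinCard P k → (∀ D → P D → m ≤ ∣ D ∣) → m ≤ k
IsMinCard⇒≤ ((D , PD , ∣D∣≡k) , _) bound = ≤-trans (bound D PD) (≤-reflexive ∣D∣≡k)

IsMinCard-mono : ∀ {n} {P Q : Subset n → Set} {k l : ℕ} →
                 (∀ {D} → P D → Q D) → IsMinCard P k → IsMinCard Q l → l ≤ k
IsMinCard-mono P⇒Q minP (_ , minQ) = IsMinCard⇒≤ minP (λ D PD → minQ D (P⇒Q PD))

∈localMaxima⇒IsLocalMax : ∀ {n} (G : Graph n) (c : Fin n → ℕ) {v} →
                          v ∈ localMaxima G c → IsLocalMax G c v
∈localMaxima⇒IsLocalMax G c {v} v∈M =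
  toWitness (Equivalence.from T-≡ (≡.trans (≡.sym (lookup∘tabulate _ v)) ([]=⇒lookup v∈M)))

upColorDominating⇒dominating : ∀ {n} (G : Graph n) (c : Fin n → ℕ) {D : Subset n} →
                               IsUpColorDominating G c D → IsDominating G D
upColorDominating⇒dominating G c (up , _) v v∉D with up v v∉D
... | d , d∈D , v~d , _ = d , d∈D , v~d

localMaxima⊆upColorDominating : ∀ {n} (G : Graph n) (c : Fin n → ℕ) {D : Subset n} →
                                IsUpColorDominating G c D → localMaxima G c ⊆ D
localMaxima⊆upColorDominating G c {D} (up , _) {v} v∈M with v ∈? D
... | yes v∈D = v∈D
... | no v∉D with up v v∉D
...   | d , _ , v~d , cv<cd = ⊥-elim (<⇒≱ cv<cd (∈localMaxima⇒IsLocalMax G c v∈M d v~d))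

lemma2 : ∀ {n} (G : Graph n) (c : Fin n → ℕ) → IsColoring G c →
           ∀ (guc gam : ℕ) → IsUpColorDominationNumber G c guc →
           IsDominationNumber G gam →
           ∣ localMaxima G c ∣ ⊔ gam ≤ guc
lemma2 G c _ guc gam γuc γ =
  ⊔-lub (IsMinCard⇒≤ γuc (λ D ucD → p⊆q⇒∣p∣≤∣q∣ (localMaxima⊆upColorDominating G c ucD)))
        (IsMinCard-mono (upColorDominating⇒dominating G c) γuc γ)
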